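{- Let $G\le\mathrm{Sym}(n)$ be transitive, and suppose that $\mathrm{Der}(G)\cup\{1\}$ is a subgroup of $G$ and that $\mathrm{Der}(G)\not\subseteq\mathrm{Alt}(n)$. If $D$ is a nonempty inverse-closed subset of $\mathrm{Der}(G)\setminus\mathrm{Alt}(n)$, then $\alpha(\mathrm{Cay}(G,\mathrm{Der}(G)\setminus D))=2\alpha(\Gamma_G)$.
   Context: A derangement is a permutation with no fixed point; $\mathrm{Der}(G)$ is the set of derangements of $G$; $1$ is the identity. For inverse-closed $S\subseteq G$ not containing the identity, $\mathrm{Cay}(G,S)$ is the graph on $G$ with $g,h$ adjacent iff $g^{ -1}h\in S$; $\Gamma_G=\mathrm{Cay}(G,\mathrm{Der}(G))$; $\alpha$ denotes independence number. -}

module Defs where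

open import Level using (0ℓ)
open import Data.Nat using (ℕ; _*_)
open import Data.Nat.Divisibility using (_∣_)
open import Data.Fin using (Fin; _<?_)
open import Data.Fin.Permutation using (Permutation′; _⟨$⟩ʳ_; _≈_; id; flip; _∘ₚ_)
open import Data.List using (List; length; filter; cartesianProduct; allFin)
open import Data.List.Relation.Unary.All using (All)
open import Data.List.Relation.Unary.AllPairs using (AllPairs)
open import Data.Product using (Σ; ∃; _×_; _,_; proj₁; proj₂)
open import Data.Sum using (_⊎_)
open import Relation.Nullary using (¬_)
open import Relation.Binary.PropositionalEquality using (_≡_; _≢_)

-- Elements of Sym(n): permutations of Fin n, compared pointwise (_≈_).
Perm : ℕ → Set
Perm n = Permutation′ n

-- Subsets of Sym(n) are predicates (respecting pointwise equality).
PSet : ℕ → Set₁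
PSet n = Perm n → Set

-- Group product as in Sym(n): (g · h)(i) = g (h i).
_·_ : ∀ {n} → Perm n → Perm n → Perm n
g · h = h ∘ₚ g

_⁻¹ : ∀ {n} → Perm n → Perm n
g ⁻¹ = flip g

Respects≈ : ∀ {n} → PSet n → Set
Respects≈ {n} S = ∀ {g h : Perm n} → g ≈ h → S g → S h

record IsSubgroup {n} (G : PSet n) : Set where
  field
    resp    : Respects≈ G
    has-id  : G id
    mul-cl  : ∀ {g h} → G g → G h → G (g · h)
    inv-cl  : ∀ {g} → G g → G (g ⁻¹)

IsTransitive : ∀ {n} → PSet n → Set
IsTransitive {n} G = ∀ (i j : Fin n) → ∃ λ g → G g × (g ⟨$⟩ʳ i ≡ j)

Der : ∀ {n} → PSet n → PSet n
Der G g = G g × (∀ i → g ⟨$⟩ʳ i ≢ i)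

inversions : ∀ {n} → Perm n → ℕ
inversions {n} σ =
  length (filter (λ p → (σ ⟨$⟩ʳ proj₂ p) <? (σ ⟨$⟩ʳ proj₁ p))
           (filter (λ p → proj₁ p <? proj₂ p) (cartesianProduct (allFin n) (allFin n))))

Alt : ∀ {n} → PSet n
Alt σ = 2 ∣ inversions σ

UnionIdIsSubgroup : ∀ {n} → PSet n → Set
UnionIdIsSubgroup {n} S =
  (∀ {g h} → (S g ⊎ g ≈ id) → (S h ⊎ h ≈ id) → (S (g · h) ⊎ (g · h) ≈ id)) ×
  (∀ {g} → (S g ⊎ g ≈ id) → (S (g ⁻¹) ⊎ (g ⁻¹) ≈ id))

InverseClosed : ∀ {n} → PSet n → Set
InverseClosed S = ∀ {g} → S g → S (g ⁻¹)

_⊆_ : ∀ {n} → PSet n → PSet n → Set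
S ⊆ T = ∀ {g} → S g → T g

Adj : ∀ {n} → PSet n → Perm n → Perm n → Set
Adj S g h = S ((g ⁻¹) · h)

IsIndependent : ∀ {n} → PSet n → PSet n → List (Perm n) → Set
IsIndependent G S I =
  All G I × AllPairs (λ g h → ¬ (g ≈ h) × ¬ Adj S g h × ¬ Adj S h g) I

IsIndependenceNumber : ∀ {n} → PSet n → PSet n → ℕ → Set
IsIndependenceNumber {n} G S k =
  (∃ λ (I : List (Perm n)) → IsIndependent G S I × length I ≡ k) ×
  (∀ (I : List (Perm n)) → IsIndependent G S I → Data.Nat._≤_ (length I) k)

_∖_ : ∀ {n} → PSet n → PSet n → PSet n
(S ∖ T) g = S g × ¬ T g

-- Write H = Der(G) ∪ {1}, a subgroup by hypothesis. Distinct g, h are non-adjacent in Γ_G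
-- exactly when g⁻¹h ∉ H, i.e. when they lie in different left cosets of H.
-- Lower bound: for d ∈ D, replacing each g of an independent set of Γ_G by g and gd keeps
-- the cosets apart, while g⁻¹(gd) = d is no longer a connection element.
-- Upper bound: inside an independent set I of Cay(G, Der(G) ∖ D) every Γ_G-edge x ~ y has
-- x⁻¹y ∈ D, so x⁻¹y is odd. No x has two such neighbours y ≠ z: then y⁻¹z ∈ H ∖ {1} would be
-- odd too, although (x⁻¹y)(y⁻¹z) = x⁻¹z. These edges thus form a matching, and keeping one
-- endpoint of each leaves an independent set of Γ_G with at least half the elements of I.
-- The sign is multiplicative: modulo 2, a pair i < j is inverted by στ iff τ inverts it or
-- σ reverses the order of τi and τj, but not both. Whether σ reverses two points depends only
-- on the unordered pair, and τ permutes unordered pairs, so the second count is that of σ.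

module Submission where

open import Defs
open import Data.Nat.Base using (ℕ; zero; suc; _+_; _*_; _≤_; z≤n; s≤s; parity)
open import Data.Nat.Divisibility using (_∣_; divides; _∣0; ∣-refl; ∣m∣n⇒∣m+n)
open import Data.Nat.Properties using (≤-refl; ≤-trans; *-suc; *-monoʳ-≤)
open import Data.Parity.Base as ℙ using (Parity; 0ℙ; 1ℙ)
import Data.Parity.Properties as ℙ
open import Algebra.Properties.CommutativeMonoid.Sum ℙ.+-0-commutativeMonoid
  using (sum; ∑-distrib-+; ∑-comm; ∑-permute; sum-cong-≗)
open import Data.Fin.Base as Fin using (Fin)
open import Data.Fin.Properties using (_<?_; <-cmp; <-irrefl; all?; _≟_)
open import Data.Fin.Permutation using (_⟨$⟩ʳ_; _⟨$⟩ˡ_; _≈_; id; inverseʳ; inverseˡ)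
open import Function.Bundles using (Injection)
open import Function.Properties.Inverse using (Inverse⇒Injection)
open import Data.List.Base using (List; []; _∷_; _++_; map; length; filter; tabulate; allFin; cartesianProduct)
open import Data.List.Properties using (length-filter; filter-all)
open import Data.List.Relation.Unary.All as All using (All; []; _∷_)
import Data.List.Relation.Unary.All.Properties as All
open import Data.List.Relation.Unary.AllPairs using (AllPairs; []; _∷_)
import Data.List.Relation.Unary.AllPairs.Properties as AllPairs
open import Data.List.Relation.Binary.Sublist.Propositional using ([]; _∷_; ⊆-trans) renaming (_⊆_ to _⊑_)
open import Data.List.Relation.Binary.Sublist.Propositional.Properties using (All-resp-⊆; filter-⊆)
open import Data.Product.Base using (∃; _×_; _,_; proj₁; proj₂)
open import Data.Sum.Base using (_⊎_; inj₁; inj₂)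
open import Data.Empty using (⊥)
open import Function.Base using (_∘_)
open import Relation.Binary.Definitions using (tri<; tri≈; tri>)
open import Relation.Nullary.Decidable using (Dec; yes; no; ¬?)
open import Relation.Nullary.Negation using (¬_; contradiction)
open import Relation.Unary using (Decidable)
open import Relation.Binary.PropositionalEquality using (_≡_; _≢_; refl; sym; trans; cong; cong₂; module ≡-Reasoning)
open ≡-Reasoning

-- Sign of a permutation

𝟙 : ∀ {p} {P : Set p} → Dec P → Parity
𝟙 (yes _) = 1ℙ
𝟙 (no _)  = 0ℙ

𝟙-yes : ∀ {p} {P : Set p} (P? : Dec P) → P → 𝟙 P? ≡ 1ℙ
𝟙-yes (yes _) _  = refl
𝟙-yes (no ¬p) p = contradiction p ¬p

𝟙-no : ∀ {p} {P : Set p} (P? : Dec P) → ¬ P → 𝟙 P? ≡ 0ℙ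
𝟙-no (yes p) ¬p = contradiction p ¬p
𝟙-no (no _)  _  = refl

sumₗ : ∀ {A : Set} → (A → Parity) → List A → Parity
sumₗ f []       = 0ℙ
sumₗ f (x ∷ xs) = f x ℙ.+ sumₗ f xs

module _ {A : Set} where

  parity-length-filter : ∀ {P : A → Set} (P? : Decidable P) xs →
    parity (length (filter P? xs)) ≡ sumₗ (𝟙 ∘ P?) xs
  parity-length-filter P? []       = refl
  parity-length-filter P? (x ∷ xs) with P? x
  ... | yes _ = trans (ℙ.+-homo-+ 1 (length (filter P? xs))) (cong (1ℙ ℙ.+_) (parity-length-filter P? xs))
  ... | no _  = parity-length-filter P? xs

  sumₗ-filter : ∀ {Q : A → Set} (Q? : Decidable Q) (f : A → Parity) xs →
    sumₗ f (filter Q? xs) ≡ sumₗ (λ x → 𝟙 (Q? x) ℙ.* f x) xs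
  sumₗ-filter Q? f []       = refl
  sumₗ-filter Q? f (x ∷ xs) with Q? x
  ... | yes _ = cong (f x ℙ.+_) (sumₗ-filter Q? f xs)
  ... | no _  = sumₗ-filter Q? f xs

  sumₗ-++ : ∀ (f : A → Parity) xs ys → sumₗ f (xs ++ ys) ≡ sumₗ f xs ℙ.+ sumₗ f ys
  sumₗ-++ f []       ys = refl
  sumₗ-++ f (x ∷ xs) ys = trans (cong (f x ℙ.+_) (sumₗ-++ f xs ys)) (sym (ℙ.+-assoc (f x) _ _))

  sumₗ-map : ∀ {B : Set} (f : A → Parity) (g : B → A) xs → sumₗ f (map g xs) ≡ sumₗ (f ∘ g) xs
  sumₗ-map f g []       = refl
  sumₗ-map f g (x ∷ xs) = cong (f (g x) ℙ.+_) (sumₗ-map f g xs)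

  sumₗ-tabulate : ∀ {n} (f : A → Parity) (g : Fin n → A) → sumₗ f (tabulate g) ≡ sum (f ∘ g)
  sumₗ-tabulate {zero}  f g = refl
  sumₗ-tabulate {suc n} f g = cong (f (g Fin.zero) ℙ.+_) (sumₗ-tabulate f (g ∘ Fin.suc))

sumₗ-cartesianProduct : ∀ {A B : Set} (f : A × B → Parity) (xs : List A) (ys : List B) →
  sumₗ f (cartesianProduct xs ys) ≡ sumₗ (λ x → sumₗ (λ y → f (x , y)) ys) xs
sumₗ-cartesianProduct f []       ys = refl
sumₗ-cartesianProduct f (x ∷ xs) ys = begin
  sumₗ f (map (λ y → x , y) ys ++ cartesianProduct xs ys)
    ≡⟨ sumₗ-++ f (map (λ y → x , y) ys) _ ⟩
  sumₗ f (map (λ y → x , y) ys) ℙ.+ sumₗ f (cartesianProduct xs ys)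
    ≡⟨ cong₂ ℙ._+_ (sumₗ-map f (λ y → x , y) ys) (sumₗ-cartesianProduct f xs ys) ⟩
  sumₗ (λ y → f (x , y)) ys ℙ.+ sumₗ (λ x → sumₗ (λ y → f (x , y)) ys) xs ∎

⟨$⟩ʳ-injective : ∀ {n} (π : Perm n) {i j} → π ⟨$⟩ʳ i ≡ π ⟨$⟩ʳ j → i ≡ j
⟨$⟩ʳ-injective π = Injection.injective (Inverse⇒Injection π)

[_<_] : ∀ {n} → Fin n → Fin n → Parity
[ a < b ] = 𝟙 (a <? b)

sum² : ∀ {n} → (Fin n → Fin n → Parity) → Parity
sum² f = sum λ i → sum λ j → f i j

inversionParity : ∀ {n} → Perm n → Parity
inversionParity σ = sum² λ i j → [ i < j ] ℙ.* [ σ ⟨$⟩ʳ j < σ ⟨$⟩ʳ i ]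

sumₗ-allFin² : ∀ {n} (f : Fin n × Fin n → Parity) →
  sumₗ f (cartesianProduct (allFin n) (allFin n)) ≡ sum² λ i j → f (i , j)
sumₗ-allFin² {n} f = begin
  sumₗ f (cartesianProduct (allFin n) (allFin n))
    ≡⟨ sumₗ-cartesianProduct f (allFin n) (allFin n) ⟩
  sumₗ (λ i → sumₗ (λ j → f (i , j)) (allFin n)) (allFin n)
    ≡⟨ sumₗ-tabulate (λ i → sumₗ (λ j → f (i , j)) (allFin n)) (λ i → i) ⟩
  sum (λ i → sumₗ (λ j → f (i , j)) (allFin n))
    ≡⟨ sum-cong-≗ (λ i → sumₗ-tabulate (λ j → f (i , j)) (λ j → j)) ⟩
  sum² (λ i j → f (i , j)) ∎

parity-inversions : ∀ {n} (σ : Perm n) → parity (inversions σ) ≡ inversionParity σ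
parity-inversions {n} σ = begin
  parity (inversions σ)
    ≡⟨ parity-length-filter inverted? (filter increasing? pairs) ⟩
  sumₗ (𝟙 ∘ inverted?) (filter increasing? pairs)
    ≡⟨ sumₗ-filter increasing? (𝟙 ∘ inverted?) pairs ⟩
  sumₗ (λ p → 𝟙 (increasing? p) ℙ.* 𝟙 (inverted? p)) pairs
    ≡⟨ sumₗ-allFin² (λ p → 𝟙 (increasing? p) ℙ.* 𝟙 (inverted? p)) ⟩
  inversionParity σ ∎
  where
  pairs : List (Fin n × Fin n)
  pairs = cartesianProduct (allFin n) (allFin n)
  increasing? : ∀ p → Dec (proj₁ p Fin.< proj₂ p)
  increasing? p = proj₁ p <? proj₂ p
  inverted? : ∀ p → Dec (σ ⟨$⟩ʳ proj₂ p Fin.< σ ⟨$⟩ʳ proj₁ p)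
  inverted? p = (σ ⟨$⟩ʳ proj₂ p) <? (σ ⟨$⟩ʳ proj₁ p)

[<]-irrefl : ∀ {n} {a b : Fin n} → a ≡ b → [ a < b ] ≡ 0ℙ
[<]-irrefl {a = a} refl = 𝟙-no (a <? a) (<-irrefl refl)

[<]≡1ℙ⇒≢ : ∀ {n} {a b : Fin n} → [ a < b ] ≡ 1ℙ → a ≢ b
[<]≡1ℙ⇒≢ a<b a≡b with () ← trans (sym a<b) ([<]-irrefl a≡b)

data Order {n} (a b : Fin n) : Set where
  less    : [ a < b ] ≡ 1ℙ → [ b < a ] ≡ 0ℙ → Order a b
  equal   : a ≡ b → Order a b
  greater : [ a < b ] ≡ 0ℙ → [ b < a ] ≡ 1ℙ → Order a b

order : ∀ {n} (a b : Fin n) → Order a b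
order a b with <-cmp a b
... | tri< a<b _ b≮a = less (𝟙-yes (a <? b) a<b) (𝟙-no (b <? a) b≮a)
... | tri≈ _ a≡b _   = equal a≡b
... | tri> a≮b _ b<a = greater (𝟙-no (a <? b) a≮b) (𝟙-yes (b <? a) b<a)

-- Data.Parity gives ℙ._+_ and ℙ._*_ the same precedence, hence the parentheses.
module _ {m n} (i j : Fin m) (x y : Fin n) where

  [<]-split : (x ≡ y → i ≡ j) → ∀ p →
    [ i < j ] ℙ.* p ≡ ([ x < y ] ℙ.* ([ i < j ] ℙ.* p)) ℙ.+ ([ y < x ] ℙ.* ([ i < j ] ℙ.* p))
  [<]-split inj p with order x y
  ... | less x<y y≮x    rewrite x<y | y≮x = sym (ℙ.+-identityʳ _)
  ... | greater x≮y y<x rewrite x≮y | y<x = refl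
  ... | equal refl      rewrite [<]-irrefl {a = x} refl | [<]-irrefl (inj refl) = refl

  [<]-merge : (i ≡ j → x ≡ y) → ∀ p →
    ([ x < y ] ℙ.* ([ i < j ] ℙ.* p)) ℙ.+ ([ x < y ] ℙ.* ([ j < i ] ℙ.* p)) ≡ [ x < y ] ℙ.* p
  [<]-merge inj p with order x y | order i j
  ... | greater x≮y _ | _               rewrite x≮y = refl
  ... | equal refl    | _               rewrite [<]-irrefl {a = x} refl = refl
  ... | less x<y _    | less i<j j≮i    rewrite x<y | i<j | j≮i = ℙ.+-identityʳ p
  ... | less x<y _    | greater i≮j j<i rewrite x<y | i≮j | j<i = refl
  ... | less x<y _    | equal i≡j       = contradiction (inj i≡j) ([<]≡1ℙ⇒≢ x<y)

reversal : ∀ {n} → Perm n → Fin n → Fin n → Parity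
reversal σ a b = ([ a < b ] ℙ.* [ σ ⟨$⟩ʳ b < σ ⟨$⟩ʳ a ]) ℙ.+ ([ b < a ] ℙ.* [ σ ⟨$⟩ʳ a < σ ⟨$⟩ʳ b ])

reversal-sym : ∀ {n} (σ : Perm n) a b → reversal σ a b ≡ reversal σ b a
reversal-sym σ a b = ℙ.+-comm ([ a < b ] ℙ.* [ σ ⟨$⟩ʳ b < σ ⟨$⟩ʳ a ]) _

[<]-reversal : ∀ {n} (σ : Perm n) a b →
  [ a < b ] ℙ.* reversal σ a b ≡ [ a < b ] ℙ.* [ σ ⟨$⟩ʳ b < σ ⟨$⟩ʳ a ]
[<]-reversal σ a b with order a b
... | less a<b b≮a    rewrite a<b | b≮a = ℙ.+-identityʳ _
... | greater a≮b _   rewrite a≮b = refl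
... | equal refl      rewrite [<]-irrefl {a = a} refl = refl

[<]-reversal-∘ : ∀ {n} (σ τ : Perm n) i j →
  [ i < j ] ℙ.* [ σ ⟨$⟩ʳ (τ ⟨$⟩ʳ j) < σ ⟨$⟩ʳ (τ ⟨$⟩ʳ i) ] ≡
  ([ i < j ] ℙ.* [ τ ⟨$⟩ʳ j < τ ⟨$⟩ʳ i ]) ℙ.+ ([ i < j ] ℙ.* reversal σ (τ ⟨$⟩ʳ i) (τ ⟨$⟩ʳ j))
[<]-reversal-∘ σ τ i j with order i j
... | greater i≮j _ rewrite i≮j = refl
... | equal refl    rewrite [<]-irrefl {a = i} refl = refl
... | less i<j _    rewrite i<j with order (τ ⟨$⟩ʳ i) (τ ⟨$⟩ʳ j)
...   | less x<y y≮x    rewrite x<y | y≮x = sym (ℙ.+-identityʳ _)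
...   | equal x≡y       = contradiction (⟨$⟩ʳ-injective τ x≡y) ([<]≡1ℙ⇒≢ i<j)
...   | greater x≮y y<x rewrite x≮y | y<x with order (σ ⟨$⟩ʳ (τ ⟨$⟩ʳ i)) (σ ⟨$⟩ʳ (τ ⟨$⟩ʳ j))
...     | less u<v v≮u    rewrite u<v | v≮u = refl
...     | greater u≮v v<u rewrite u≮v | v<u = refl
...     | equal u≡v       = contradiction (⟨$⟩ʳ-injective σ (sym u≡v)) ([<]≡1ℙ⇒≢ y<x)

module _ {n : ℕ} where

  sum²-cong : {f g : Fin n → Fin n → Parity} → (∀ i j → f i j ≡ g i j) → sum² f ≡ sum² g
  sum²-cong f≗g = sum-cong-≗ λ i → sum-cong-≗ (f≗g i)

  sum²-distrib-+ : (f g : Fin n → Fin n → Parity) →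
    sum² (λ i j → f i j ℙ.+ g i j) ≡ sum² f ℙ.+ sum² g
  sum²-distrib-+ f g = trans (sum-cong-≗ λ i → ∑-distrib-+ (f i) (g i))
                             (∑-distrib-+ (λ i → sum (f i)) (λ i → sum (g i)))

  sum²-transpose : (f : Fin n → Fin n → Parity) → sum² (λ i j → f j i) ≡ sum² f
  sum²-transpose f = ∑-comm λ i j → f j i

  sum²-permute : (f : Fin n → Fin n → Parity) (τ : Perm n) →
    sum² (λ i j → f (τ ⟨$⟩ʳ i) (τ ⟨$⟩ʳ j)) ≡ sum² f
  sum²-permute f τ = sym (trans (sum-cong-≗ λ i → ∑-permute (f i) τ)
                                (∑-permute (λ i → sum λ j → f i (τ ⟨$⟩ʳ j)) τ))

  sum²-upper-permute : (g : Fin n → Fin n → Parity) → (∀ a b → g a b ≡ g b a) → (π : Perm n) →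
    sum² (λ i j → [ i < j ] ℙ.* g (π ⟨$⟩ʳ i) (π ⟨$⟩ʳ j)) ≡ sum² (λ a b → [ a < b ] ℙ.* g a b)
  sum²-upper-permute g g-sym π = begin
    sum² (λ i j → [ i < j ] ℙ.* h i j)
      ≡⟨ sum²-cong (λ i j → [<]-split i j (τ i) (τ j) (⟨$⟩ʳ-injective π) (h i j)) ⟩
    sum² (λ i j → below i j ℙ.+ ([ τ j < τ i ] ℙ.* ([ i < j ] ℙ.* h i j)))
      ≡⟨ sum²-distrib-+ below _ ⟩
    sum² below ℙ.+ sum² (λ i j → [ τ j < τ i ] ℙ.* ([ i < j ] ℙ.* h i j))
      ≡⟨ cong (sum² below ℙ.+_) (sum²-transpose (λ i j → [ τ i < τ j ] ℙ.* ([ j < i ] ℙ.* h j i))) ⟩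
    sum² below ℙ.+ sum² (λ i j → [ τ i < τ j ] ℙ.* ([ j < i ] ℙ.* h j i))
      ≡⟨ cong (sum² below ℙ.+_) (sum²-cong λ i j → cong (λ t → [ τ i < τ j ] ℙ.* ([ j < i ] ℙ.* t)) (g-sym _ _)) ⟩
    sum² below ℙ.+ sum² (λ i j → [ τ i < τ j ] ℙ.* ([ j < i ] ℙ.* h i j))
      ≡⟨ sym (sum²-distrib-+ below _) ⟩
    sum² (λ i j → below i j ℙ.+ ([ τ i < τ j ] ℙ.* ([ j < i ] ℙ.* h i j)))
      ≡⟨ sum²-cong (λ i j → [<]-merge i j (τ i) (τ j) (cong (π ⟨$⟩ʳ_)) (h i j)) ⟩
    sum² (λ i j → [ τ i < τ j ] ℙ.* h i j)
      ≡⟨ sum²-permute (λ a b → [ a < b ] ℙ.* g a b) π ⟩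
    sum² (λ a b → [ a < b ] ℙ.* g a b) ∎
    where
    τ : Fin n → Fin n
    τ = π ⟨$⟩ʳ_
    h : Fin n → Fin n → Parity
    h i j = g (τ i) (τ j)
    below : Fin n → Fin n → Parity
    below i j = [ τ i < τ j ] ℙ.* ([ i < j ] ℙ.* h i j)

inversionParity-· : ∀ {n} (σ τ : Perm n) →
  inversionParity (σ · τ) ≡ inversionParity τ ℙ.+ inversionParity σ
inversionParity-· σ τ = begin
  inversionParity (σ · τ)
    ≡⟨ sum²-cong ([<]-reversal-∘ σ τ) ⟩
  sum² (λ i j → ([ i < j ] ℙ.* [ τ ⟨$⟩ʳ j < τ ⟨$⟩ʳ i ]) ℙ.+ ([ i < j ] ℙ.* reversal σ (τ ⟨$⟩ʳ i) (τ ⟨$⟩ʳ j)))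
    ≡⟨ sum²-distrib-+ (λ i j → [ i < j ] ℙ.* [ τ ⟨$⟩ʳ j < τ ⟨$⟩ʳ i ]) _ ⟩
  inversionParity τ ℙ.+ sum² (λ i j → [ i < j ] ℙ.* reversal σ (τ ⟨$⟩ʳ i) (τ ⟨$⟩ʳ j))
    ≡⟨ cong (inversionParity τ ℙ.+_) (sum²-upper-permute (reversal σ) (reversal-sym σ) τ) ⟩
  inversionParity τ ℙ.+ sum² (λ a b → [ a < b ] ℙ.* reversal σ a b)
    ≡⟨ cong (inversionParity τ ℙ.+_) (sum²-cong ([<]-reversal σ)) ⟩
  inversionParity τ ℙ.+ inversionParity σ ∎

2∣⇒parity≡0ℙ : ∀ {m} → 2 ∣ m → parity m ≡ 0ℙ
2∣⇒parity≡0ℙ (divides q refl) = trans (ℙ.*-homo-* q 2) (ℙ.*-zeroʳ (parity q))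

parity≡0ℙ⇒2∣ : ∀ m → parity m ≡ 0ℙ → 2 ∣ m
parity≡0ℙ⇒2∣ zero          _  = 2 ∣0
parity≡0ℙ⇒2∣ (suc (suc m)) eq = ∣m∣n⇒∣m+n ∣-refl (parity≡0ℙ⇒2∣ m eq)

Alt⇒inversionParity≡0ℙ : ∀ {n} (σ : Perm n) → Alt σ → inversionParity σ ≡ 0ℙ
Alt⇒inversionParity≡0ℙ σ even = trans (sym (parity-inversions σ)) (2∣⇒parity≡0ℙ even)

inversionParity≡0ℙ⇒Alt : ∀ {n} (σ : Perm n) → inversionParity σ ≡ 0ℙ → Alt σ
inversionParity≡0ℙ⇒Alt σ eq = parity≡0ℙ⇒2∣ (inversions σ) (trans (parity-inversions σ) eq)

¬Alt⇒inversionParity≡1ℙ : ∀ {n} (σ : Perm n) → ¬ Alt σ → inversionParity σ ≡ 1ℙ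
¬Alt⇒inversionParity≡1ℙ σ odd with inversionParity σ in eq
... | 0ℙ = contradiction (inversionParity≡0ℙ⇒Alt σ eq) odd
... | 1ℙ = refl

inversionParity-cong : ∀ {n} {σ σ′ : Perm n} → σ ≈ σ′ → inversionParity σ ≡ inversionParity σ′
inversionParity-cong σ≈σ′ = sum²-cong λ i j → cong₂ (λ a b → [ i < j ] ℙ.* [ a < b ]) (σ≈σ′ j) (σ≈σ′ i)

Alt-resp : ∀ {n} → Respects≈ (Alt {n})
Alt-resp {g = σ} {h = σ′} σ≈σ′ even =
  inversionParity≡0ℙ⇒Alt σ′ (trans (sym (inversionParity-cong {σ = σ} {σ′} σ≈σ′)) (Alt⇒inversionParity≡0ℙ σ even))

¬Alt-·-¬Alt : ∀ {n} (σ τ : Perm n) → ¬ Alt σ → ¬ Alt τ → Alt (σ · τ)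
¬Alt-·-¬Alt σ τ σ-odd τ-odd = inversionParity≡0ℙ⇒Alt (σ · τ) (begin
  inversionParity (σ · τ)
    ≡⟨ inversionParity-· σ τ ⟩
  inversionParity τ ℙ.+ inversionParity σ
    ≡⟨ cong₂ ℙ._+_ (¬Alt⇒inversionParity≡1ℙ τ τ-odd) (¬Alt⇒inversionParity≡1ℙ σ σ-odd) ⟩
  1ℙ ℙ.+ 1ℙ ∎)

¬Alt⇒Fin : ∀ {n} (σ : Perm n) → ¬ Alt σ → Fin n
¬Alt⇒Fin {zero}  _ odd = contradiction (2 ∣0) odd
¬Alt⇒Fin {suc n} _ _   = Fin.zero

-- One endpoint of each edge of a matching

module _ {A : Set} {Q : A → Set} (Q? : ∀ x → Dec (Q x)) where

  length≤1+length-filter-¬ : ∀ {xs} → AllPairs (λ y z → Q y → Q z → ⊥) xs →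
    length xs ≤ suc (length (filter (¬? ∘ Q?) xs))
  length≤1+length-filter-¬ {[]}     _        = z≤n
  length≤1+length-filter-¬ {x ∷ xs} (Qx⇒¬Q ∷ Q-unique) with Q? x
  ... | yes Qx rewrite filter-all (¬? ∘ Q?) (All.map (λ Qx⇒¬Qy → Qx⇒¬Qy Qx) Qx⇒¬Q) = ≤-refl
  ... | no _   = s≤s (length≤1+length-filter-¬ Q-unique)

module _ {A : Set} {P : A → Set} {R R′ E : A → A → Set} (E? : ∀ x y → Dec (E x y))
  (no-fork : ∀ {x y z} → P x → P y → P z → R x y → R x z → R y z → E x y → E x z → ⊥)
  (refine : ∀ {x y} → R x y → ¬ E x y → R′ x y) where

  private
    fork-free : ∀ {x xs} → P x → All (λ y → P y × R x y) xs → AllPairs R xs →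
      AllPairs (λ y z → E x y → E x z → ⊥) xs
    fork-free Px []                []             = []
    fork-free Px ((Py , Rxy) ∷ ps) (Ry ∷ Rs) =
      All.zipWith (λ ((Pz , Rxz) , Ryz) → no-fork Px Py Pz Rxy Rxz Ryz) (ps , Ry) ∷ fork-free Px ps Rs

    -- m is fuel: the recursive call is on a filtered tail.
    greedy : ∀ m xs → length xs ≤ m → All P xs → AllPairs R xs →
      ∃ λ ys → ys ⊑ xs × AllPairs R′ ys × length xs ≤ 2 * length ys
    greedy _       []       _            _          _         = [] , [] , [] , z≤n
    greedy (suc m) (x ∷ xs) (s≤s |xs|≤m) (Px ∷ Pxs) (Rx ∷ Rxs)
      with greedy m (filter (¬? ∘ E? x) xs) (≤-trans (length-filter (¬? ∘ E? x) xs) |xs|≤m)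
                    (All.filter⁺ (¬? ∘ E? x) Pxs) (AllPairs.filter⁺ (¬? ∘ E? x) Rxs)
    ... | ys , ys⊑ , R′ys , bound =
      x ∷ ys , refl ∷ ⊆-trans ys⊑ (filter-⊆ ¬E? xs) , All-resp-⊆ ys⊑ R′x-kept ∷ R′ys , 1+|xs|≤2|x∷ys|
      where
      ¬E? : ∀ y → Dec (¬ E x y)
      ¬E? = ¬? ∘ E? x
      R′x-kept : All (R′ x) (filter ¬E? xs)
      R′x-kept = All.map (λ (Rxy , ¬Exy) → refine Rxy ¬Exy) (All.zip (All.filter⁺ ¬E? Rx , All.all-filter ¬E? xs))
      1+|xs|≤2|x∷ys| : suc (length xs) ≤ 2 * suc (length ys)
      1+|xs|≤2|x∷ys| rewrite *-suc 2 (length ys) =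
        s≤s (≤-trans (length≤1+length-filter-¬ (E? x) (fork-free Px (All.zip (Pxs , Rx)) Rxs)) (s≤s bound))

  ∃-half-sublist : ∀ xs → All P xs → AllPairs R xs →
    ∃ λ ys → ys ⊑ xs × AllPairs R′ ys × length xs ≤ 2 * length ys
  ∃-half-sublist xs = greedy (length xs) xs ≤-refl

-- Cosets of Der(G) ∪ {1}

FixedPointFree : ∀ {n} → Perm n → Set
FixedPointFree σ = ∀ i → σ ⟨$⟩ʳ i ≢ i

fixedPointFree? : ∀ {n} (σ : Perm n) → Dec (FixedPointFree σ)
fixedPointFree? σ = all? λ i → ¬? (σ ⟨$⟩ʳ i ≟ i)

⁻¹·-fixed-sym : ∀ {n} (x y : Perm n) {i} → ((x ⁻¹) · y) ⟨$⟩ʳ i ≡ i → ((y ⁻¹) · x) ⟨$⟩ʳ i ≡ i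
⁻¹·-fixed-sym x y {i} fixed = trans (cong (y ⟨$⟩ˡ_) (sym yi≡xi)) (inverseˡ y)
  where
  yi≡xi : y ⟨$⟩ʳ i ≡ x ⟨$⟩ʳ i
  yi≡xi = trans (sym (inverseʳ x)) (cong (x ⟨$⟩ʳ_) fixed)

⁻¹·≈id⇒≈ : ∀ {n} (g h : Perm n) → ((g ⁻¹) · h) ≈ id → g ≈ h
⁻¹·≈id⇒≈ g h g⁻¹h≈1 i = trans (cong (g ⟨$⟩ʳ_) (sym (g⁻¹h≈1 i))) (inverseʳ g)

NonAdjacent : ∀ {n} → PSet n → Perm n → Perm n → Set
NonAdjacent S g h = ¬ (g ≈ h) × ¬ Adj S g h × ¬ Adj S h g

module Cayley {n} {G : PSet n} (G-subgroup : IsSubgroup G) (Der∪1-subgroup : UnionIdIsSubgroup (Der G)) where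

  open IsSubgroup G-subgroup

  Der∪1 : PSet n
  Der∪1 g = Der G g ⊎ g ≈ id

  Der-resp : Respects≈ (Der G)
  Der-resp g≈h (Gg , g-fpf) = resp g≈h Gg , λ i → g-fpf i ∘ trans (g≈h i)

  Der∪1-resp : Respects≈ Der∪1
  Der∪1-resp g≈h (inj₁ der) = inj₁ (Der-resp g≈h der)
  Der∪1-resp g≈h (inj₂ g≈1) = inj₂ λ i → trans (sym (g≈h i)) (g≈1 i)

  Der∪1-· : ∀ {g h} → Der∪1 g → Der∪1 h → Der∪1 (g · h)
  Der∪1-· = proj₁ Der∪1-subgroup

  Der∪1-⁻¹ : ∀ {g} → Der∪1 g → Der∪1 (g ⁻¹)
  Der∪1-⁻¹ = proj₂ Der∪1-subgroup

  NonAdjacent⇒∉Der∪1 : ∀ {g h} → NonAdjacent (Der G) g h → ¬ Der∪1 ((g ⁻¹) · h)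
  NonAdjacent⇒∉Der∪1 (_ , ¬g~h , _) (inj₁ g~h)    = ¬g~h g~h
  NonAdjacent⇒∉Der∪1 {g} {h} (g≉h , _ , _) (inj₂ g⁻¹h≈1) = g≉h (⁻¹·≈id⇒≈ g h g⁻¹h≈1)

  ∉Der∪1⇒NonAdjacent : ∀ {S g h} → S ⊆ Der G → ¬ Der∪1 ((g ⁻¹) · h) → NonAdjacent S g h
  ∉Der∪1⇒NonAdjacent {S} {g} {h} S⊆Der g⁻¹h∉ =
    (λ g≈h → g⁻¹h∉ (inj₂ λ i → trans (cong (g ⟨$⟩ˡ_) (sym (g≈h i))) (inverseˡ g))) ,
    (λ g~h → g⁻¹h∉ (inj₁ (S⊆Der g~h))) ,
    (λ h~g → g⁻¹h∉ (Der∪1-resp (λ _ → refl) (Der∪1-⁻¹ (inj₁ (S⊆Der h~g)))))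

  Der∪1-cosets-disjoint : ∀ {g h a b} → ¬ Der∪1 ((g ⁻¹) · h) →
    Der∪1 ((g ⁻¹) · a) → Der∪1 ((h ⁻¹) · b) → ¬ Der∪1 ((a ⁻¹) · b)
  Der∪1-cosets-disjoint {g} {h} {a} {b} g⁻¹h∉ g⁻¹a∈ h⁻¹b∈ a⁻¹b∈ =
    g⁻¹h∉ (Der∪1-resp telescope (Der∪1-· (Der∪1-· g⁻¹a∈ a⁻¹b∈) (Der∪1-⁻¹ h⁻¹b∈)))
    where
    telescope : ((((g ⁻¹) · a) · ((a ⁻¹) · b)) · (((h ⁻¹) · b) ⁻¹)) ≈ ((g ⁻¹) · h)
    telescope i = cong (g ⟨$⟩ˡ_) (trans (inverseʳ a) (inverseʳ b))

  module Pruned {D : PSet n} (D-resp : Respects≈ D) (D-inv : InverseClosed D) (D⊆odd : D ⊆ (Der G ∖ Alt)) where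

    doubled : Perm n → List (Perm n) → List (Perm n)
    doubled d []       = []
    doubled d (g ∷ gs) = g ∷ g · d ∷ doubled d gs

    length-doubled : ∀ d gs → length (doubled d gs) ≡ 2 * length gs
    length-doubled d []       = refl
    length-doubled d (g ∷ gs) = trans (cong (2 +_) (length-doubled d gs)) (sym (*-suc 2 (length gs)))

    All-doubled : ∀ {P Q : Perm n → Set} {d gs} → (∀ {h} → P h → Q h) → (∀ {h} → P h → Q (h · d)) →
      All P gs → All Q (doubled d gs)
    All-doubled P⇒Q P⇒Q·d []         = []
    All-doubled P⇒Q P⇒Q·d (Ph ∷ Pgs) = P⇒Q Ph ∷ P⇒Q·d Ph ∷ All-doubled P⇒Q P⇒Q·d Pgs

    doubled-independent : ∀ {d} → D d → Fin n → ∀ {J} →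
      IsIndependent G (Der G) J → IsIndependent G (Der G ∖ D) (doubled d J)
    doubled-independent {d} d∈D i₀ = go
      where
      d-der : Der G d
      d-der = proj₁ (D⊆odd d∈D)

      g∈g : ∀ g → Der∪1 ((g ⁻¹) · g)
      g∈g g = inj₂ λ _ → inverseˡ g

      g·d∈g : ∀ g → Der∪1 ((g ⁻¹) · (g · d))
      g·d∈g g = inj₁ (Der-resp (λ _ → sym (inverseˡ g)) d-der)

      across : ∀ g h a b → NonAdjacent (Der G) g h →
        Der∪1 ((g ⁻¹) · a) → Der∪1 ((h ⁻¹) · b) → NonAdjacent (Der G ∖ D) a b
      across g h a b g≁h g⁻¹a∈ h⁻¹b∈ =
        ∉Der∪1⇒NonAdjacent {Der G ∖ D} {a} {b} proj₁
          (Der∪1-cosets-disjoint {g} {h} {a} {b} (NonAdjacent⇒∉Der∪1 {g} {h} g≁h) g⁻¹a∈ h⁻¹b∈)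

      within : ∀ g → NonAdjacent (Der G ∖ D) g (g · d)
      within g =
        (λ g≈g·d → proj₂ d-der i₀ (sym (⟨$⟩ʳ-injective g (g≈g·d i₀)))) ,
        (λ (_ , d∉D) → d∉D (D-resp (λ _ → sym (inverseˡ g)) d∈D)) ,
        (λ (_ , d⁻¹∉D) → d⁻¹∉D (D-resp (λ _ → cong (d ⟨$⟩ˡ_) (sym (inverseˡ g))) (D-inv d∈D)))

      go : ∀ {J} → IsIndependent G (Der G) J → IsIndependent G (Der G ∖ D) (doubled d J)
      go {[]}    _ = [] , []
      go {g ∷ J} (Gg ∷ GJ , g≁J ∷ J-indep) =
        Gg ∷ mul-cl Gg (proj₁ d-der) ∷ proj₁ (go (GJ , J-indep)) ,
        (within g ∷ All-doubled (λ {h} g≁h → across g h g h g≁h (g∈g g) (g∈g h))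
                                (λ {h} g≁h → across g h g (h · d) g≁h (g∈g g) (g·d∈g h)) g≁J) ∷
        All-doubled (λ {h} g≁h → across g h (g · d) h g≁h (g·d∈g g) (g∈g h))
                    (λ {h} g≁h → across g h (g · d) (h · d) g≁h (g·d∈g g) (g·d∈g h)) g≁J ∷
        proj₂ (go (GJ , J-indep))

    ∉Der∖D⇒¬Alt : ∀ {p} → Der G p → ¬ (Der G ∖ D) p → ¬ Alt p
    ∉Der∖D⇒¬Alt p-der p∉Der∖D p-even = p∉Der∖D (p-der , λ p∈D → proj₂ (D⊆odd p∈D) p-even)

    no-fork : ∀ {x y z} → G x → G y → G z →
      NonAdjacent (Der G ∖ D) x y → NonAdjacent (Der G ∖ D) x z → NonAdjacent (Der G ∖ D) y z →
      FixedPointFree ((x ⁻¹) · y) → FixedPointFree ((x ⁻¹) · z) → ⊥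
    no-fork {x} {y} {z} Gx Gy Gz (_ , x≁y , _) (_ , x≁z , _) (y≉z , y≁z , _) x⁻¹y-fpf x⁻¹z-fpf =
      ∉Der∖D⇒¬Alt x⁻¹z-der x≁z
        (Alt-resp {g = ((x ⁻¹) · y) · ((y ⁻¹) · z)} {h = (x ⁻¹) · z} (λ i → cong (x ⟨$⟩ˡ_) (inverseʳ y))
          (¬Alt-·-¬Alt ((x ⁻¹) · y) ((y ⁻¹) · z) x⁻¹y-odd y⁻¹z-odd))
      where
      x⁻¹y-der : Der G ((x ⁻¹) · y)
      x⁻¹y-der = mul-cl (inv-cl Gx) Gy , x⁻¹y-fpf
      x⁻¹z-der : Der G ((x ⁻¹) · z)
      x⁻¹z-der = mul-cl (inv-cl Gx) Gz , x⁻¹z-fpf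
      x⁻¹y-odd : ¬ Alt ((x ⁻¹) · y)
      x⁻¹y-odd = ∉Der∖D⇒¬Alt x⁻¹y-der x≁y
      y⁻¹z-odd : ¬ Alt ((y ⁻¹) · z)
      y⁻¹z-odd with Der∪1-resp (λ i → cong (y ⟨$⟩ˡ_) (inverseʳ x)) (Der∪1-· (Der∪1-⁻¹ (inj₁ x⁻¹y-der)) (inj₁ x⁻¹z-der))
      ... | inj₁ y⁻¹z-der = ∉Der∖D⇒¬Alt y⁻¹z-der y≁z
      ... | inj₂ y⁻¹z≈1   = contradiction (⁻¹·≈id⇒≈ y z y⁻¹z≈1) y≉z

    fixing⇒NonAdjacent : ∀ {x y} → NonAdjacent (Der G ∖ D) x y → ¬ FixedPointFree ((x ⁻¹) · y) → NonAdjacent (Der G) x y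
    fixing⇒NonAdjacent {x} {y} (x≉y , _ , _) x⁻¹y-fixes =
      x≉y , (λ (_ , x⁻¹y-fpf) → x⁻¹y-fixes x⁻¹y-fpf) ,
            (λ (_ , y⁻¹x-fpf) → x⁻¹y-fixes λ i → y⁻¹x-fpf i ∘ ⁻¹·-fixed-sym x y)

    halved-independent : ∀ {I} → IsIndependent G (Der G ∖ D) I →
      ∃ λ J → IsIndependent G (Der G) J × length I ≤ 2 * length J
    halved-independent {I} (GI , I-indep)
      with J , J⊑I , J-indep , bound ←
        ∃-half-sublist {P = G} {R = NonAdjacent (Der G ∖ D)} {R′ = NonAdjacent (Der G)}
          (λ x y → fixedPointFree? ((x ⁻¹) · y)) no-fork (λ {x} {y} → fixing⇒NonAdjacent {x} {y}) I GI I-indep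
      = J , (All-resp-⊆ J⊑I GI , J-indep) , bound

proposition3p6 : ∀ (n : ℕ) (G : PSet n) → IsSubgroup G → IsTransitive G →
    UnionIdIsSubgroup (Der G) →
    (∃ λ g → Der G g × ¬ Alt g) →
    ∀ (D : PSet n) → Respects≈ D → (∃ λ g → D g) → InverseClosed D →
    D ⊆ (Der G ∖ Alt) →
    ∀ (k : ℕ) → IsIndependenceNumber G (Der G) k →
    IsIndependenceNumber G (Der G ∖ D) (2 * k)
proposition3p6 n G G-subgroup _ Der∪1-subgroup _ D D-resp (d , d∈D) D-inv D⊆odd k ((J , J-indep , |J|≡k) , J-max) =
  (doubled d J , doubled-independent d∈D i₀ J-indep , trans (length-doubled d J) (cong (2 *_) |J|≡k)) ,
  |I|≤2k
  where
  open Cayley G-subgroup Der∪1-subgroup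
  open Pruned D-resp D-inv D⊆odd

  i₀ : Fin n
  i₀ = ¬Alt⇒Fin d (proj₂ (D⊆odd d∈D))

  |I|≤2k : ∀ I → IsIndependent G (Der G ∖ D) I → length I ≤ 2 * k
  |I|≤2k I I-indep with J′ , J′-indep , |I|≤2|J′| ← halved-independent I-indep =
    ≤-trans |I|≤2|J′| (*-monoʳ-≤ 2 (J-max J′ J′-indep))
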